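{- Let $p\in\mathbb{Z}$ and let $q$ be a positive integer. Let $(G_n)_{n\ge0}$ be defined by $G_0=0$, $G_1=1$ and $G_n=pG_{n-1}+qG_{n-2}$ for $n\ge2$, and let $r=p^2+4q$. (1) If $r$ is a prime, then for all integers $k,n\ge0$: $r^k\mid n$ if and only if $r^k\mid G_n$. (2) If $r/4$ is a prime and $p\neq0$, then for all integers $k,n\ge0$: $(r/4)^k\mid n$ if and only if $(r/4)^k\mid G_n$.
   Context: For integers $a,b$, $a\mid b$ means there is an integer $c$ with $b=ca$ (in particular $0\mid 0$). -}

module Defs where

open import Data.Nat using (ℕ; zero; suc)
open import Data.Integer using (ℤ; +_; _+_; _*_)

G : ℤ → ℤ → ℕ → ℤ
G p q zero = + 0
G p q (suc zero) = + 1
G p q (suc (suc n)) = p * G p q (suc n) + q * G p q n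

disc : ℤ → ℤ → ℤ
disc p q = p * p + + 4 * q

-- Both parts are instances of one fact about ℤ[√π], π prime: if π ∤ a and
-- Y_n is the √π-part of (a + √π)^n, then π^k ∣ n ⇔ π^k ∣ Y_n (valuation).
-- For (1) take π = r, a = p, where 2·Y_n = 2^n·G_n; for (2) p = 2t is even,
-- s = t² + q, and Y_n = G_n for π = s, a = t (twice-im≡G, im≡G).
--
-- The fact is proved by lifting the exponent.  Truncated binomial expansions
-- of (A + B√π)^m (first order modulo B²π, second order modulo π² for B = 1)
-- show that (a + √π)^(π^k) has "level" k: rational part prime to π and
-- √π-part divisible by exactly π^k (levels; the step to level 1 is done by
-- hand for π = 2, 3).  For e of level k, π^(k+1) divides the √π-part of e^m
-- iff π ∣ m (reduce), which gives the induction step on k.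

module Submission where

open import Defs
open import Data.Nat using (ℕ)
open import Data.Nat.Primality using (Prime)
open import Data.Integer using (ℤ; +_; _*_; _>_; _^_)
open import Data.Integer.Divisibility using (_∣_)
open import Data.Product using (_×_)
open import Relation.Binary.PropositionalEquality using (_≡_; _≢_)
open import Function.Bundles using (_⇔_)

open import Level as Universe using (0ℓ)
open import Algebra.Bundles using (Monoid)
import Algebra.Properties.Monoid.Mult as MonoidMultiplication
import Data.Nat as N
open N using (zero; suc; _∸_; z≤n; s≤s)
import Data.Nat.Properties as Nᵖ
import Data.Nat.Divisibility as Nᵈ
open import Data.Nat.Primality
  using (composite; prime⇒nonZero; ¬prime[0]; ¬prime[1]; prime[2]; composite[4]; composite⇒¬prime; euclidsLemma)
open import Data.Integer using (0ℤ; 1ℤ; _+_; _-_; -_; -[1+_]; ∣_∣; _%_; _/_; +<+; NonZero)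
import Data.Integer.Properties as ℤᵖ
open import Data.Integer.DivMod using (n%d<d; a≡a%n+[a/n]*n)
import Data.Integer.Divisibility.Signed as Signed
open Signed using (divides) renaming (_∣_ to _∣ₛ_)
open import Data.Integer.Tactic.RingSolver using (solve-∀)
open import Data.Product using (Σ-syntax; _,_; proj₁; proj₂)
open import Data.Sum using (_⊎_; [_,_]′)
import Data.Sum as Sum
open import Data.Empty using (⊥-elim)
open import Relation.Nullary using (¬_)
open import Relation.Nullary.Decidable using (from-no)
open import Relation.Binary.PropositionalEquality
  using (refl; sym; trans; cong; cong₂; subst; isEquivalence; module ≡-Reasoning)
open import Relation.Binary.Bundles using (Setoid)
import Relation.Binary.Reasoning.Setoid as SetoidReasoning
open import Function.Bundles using (mk⇔; module Equivalence)
open import Function.Properties.Equivalence using (⇔-setoid)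

open import Function.Base using (id; _∘_)

open Equivalence using (to; from)

module ⇔-Reasoning = SetoidReasoning (⇔-setoid 0ℓ)

infix 4 _≡_mod_

-- x ≡ y mod n: n divides x - y.  (A record, so that x, y, n stay inferable.)
record _≡_mod_ (x y n : ℤ) : Set where
  constructor mod-by
  field
    difference : n ∣ₛ x - y

module _ {n : ℤ} where

  mod-reflexive : ∀ {x y} → x ≡ y → x ≡ y mod n
  mod-reflexive {x} refl = mod-by (divides 0ℤ (ℤᵖ.+-inverseʳ x))

  mod-sym : ∀ {x y} → x ≡ y mod n → y ≡ x mod n
  mod-sym {x} {y} (mod-by h) = mod-by (subst (n ∣ₛ_) (negate x y) (Signed.∣m⇒∣-m h))
    where
    negate : ∀ x y → - (x - y) ≡ y - x
    negate = solve-∀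

  mod-trans : ∀ {x y z} → x ≡ y mod n → y ≡ z mod n → x ≡ z mod n
  mod-trans {x} {y} {z} (mod-by h) (mod-by h′) = mod-by (subst (n ∣ₛ_) (telescope x y z) (Signed.∣m∣n⇒∣m+n h h′))
    where
    telescope : ∀ x y z → (x - y) + (y - z) ≡ x - z
    telescope = solve-∀

  mod-+ : ∀ {x y u v} → x ≡ y mod n → u ≡ v mod n → x + u ≡ y + v mod n
  mod-+ {x} {y} {u} {v} (mod-by h) (mod-by h′) = mod-by (subst (n ∣ₛ_) (regroup x y u v) (Signed.∣m∣n⇒∣m+n h h′))
    where
    regroup : ∀ x y u v → (x - y) + (u - v) ≡ (x + u) - (y + v)
    regroup = solve-∀

  mod-* : ∀ {x y u v} → x ≡ y mod n → u ≡ v mod n → x * u ≡ y * v mod n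
  mod-* {x} {y} {u} {v} (mod-by h) (mod-by h′) =
    mod-by (subst (n ∣ₛ_) (regroup x y u v) (Signed.∣m∣n⇒∣m+n (Signed.∣n⇒∣m*n x h′) (Signed.∣n⇒∣m*n v h)))
    where
    regroup : ∀ x y u v → x * (u - v) + v * (x - y) ≡ x * u - y * v
    regroup = solve-∀

  mod-*ˡ : ∀ c {x y} → x ≡ y mod n → c * x ≡ c * y mod n
  mod-*ˡ c = mod-* {x = c} {y = c} (mod-reflexive refl)

  mod-drop : ∀ x c → x + c * n ≡ x mod n
  mod-drop x c = mod-by (divides c (cancel x c n))
    where
    cancel : ∀ x c n → x + c * n - x ≡ c * n
    cancel = solve-∀

  mod-weaken : ∀ {d x y} → d ∣ₛ n → x ≡ y mod n → x ≡ y mod d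
  mod-weaken d∣n (mod-by h) = mod-by (Signed.∣-trans d∣n h)

  mod-scale : ∀ c {x y} → x ≡ y mod n → c * x ≡ c * y mod c * n
  mod-scale c {x} {y} (mod-by h) = mod-by (subst (c * n ∣ₛ_) (distribute c x y) (Signed.*-monoʳ-∣ c h))
    where
    distribute : ∀ c x y → c * (x - y) ≡ c * x - c * y
    distribute = solve-∀

  mod-∣ : ∀ {d x y} → x ≡ y mod n → d ∣ₛ n → d ∣ₛ x ⇔ d ∣ₛ y
  mod-∣ {d} {x} {y} (mod-by h) d∣n = mk⇔
    (λ d∣x → Signed.∣m+n∣m⇒∣n (subst (d ∣ₛ_) (difference x y) d∣x) (Signed.∣-trans d∣n h))
    (λ d∣y → subst (d ∣ₛ_) (sum x y) (Signed.∣m∣n⇒∣m+n (Signed.∣-trans d∣n h) d∣y))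
    where
    difference : ∀ x y → x ≡ (x - y) + y
    difference = solve-∀
    sum : ∀ x y → (x - y) + y ≡ x
    sum = solve-∀

mod-setoid : ℤ → Setoid 0ℓ 0ℓ
mod-setoid n = record
  { Carrier       = ℤ
  ; _≈_           = λ x y → x ≡ y mod n
  ; isEquivalence = record { refl = mod-reflexive refl ; sym = mod-sym ; trans = mod-trans }
  }

module ModReasoning (n : ℤ) = SetoidReasoning (mod-setoid n)

pos-^ : ∀ π k → (+ π) ^ k ≡ + (π N.^ k)
pos-^ π zero = refl
pos-^ π (suc k) = trans (cong (+ π *_) (pos-^ π k)) (sym (ℤᵖ.pos-* π (π N.^ k)))

square-abs : ∀ t → t * t ≡ + (∣ t ∣ N.* ∣ t ∣)
square-abs (+ n) = sym (ℤᵖ.pos-* n n)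
square-abs -[1+ n ] = refl

-- m·A^(m-1)·A = m·A^m; both sides vanish for m = 0.
derivative-shift : ∀ A m → A * (+ m * A ^ (m ∸ 1)) ≡ + m * A ^ m
derivative-shift A zero = ℤᵖ.*-zeroʳ A
derivative-shift A (suc m) = left-comm A (+ suc m) (A ^ m)
  where
  left-comm : ∀ x y z → x * (y * z) ≡ y * (x * z)
  left-comm = solve-∀

module PrimeDivisibility {π : ℕ} (π-prime : Prime π) where

  private
    P : ℤ
    P = + π

  instance
    P-nonZero : NonZero P
    P-nonZero = prime⇒nonZero π-prime

  power-nonZero : ∀ k → NonZero (P ^ k)
  power-nonZero k = subst (λ x → N.NonZero ∣ x ∣) (sym (pos-^ π k)) (Nᵖ.m^n≢0 π k)

  prime-∣-* : ∀ {x y} → P ∣ₛ x * y → P ∣ₛ x ⊎ P ∣ₛ y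
  prime-∣-* {x} {y} h = Sum.map Signed.∣ᵤ⇒∣ Signed.∣ᵤ⇒∣
    (euclidsLemma ∣ x ∣ ∣ y ∣ π-prime (subst (π Nᵈ.∣_) (ℤᵖ.abs-* x y) (Signed.∣⇒∣ᵤ h)))

  ∤-* : ∀ {x y} → ¬ P ∣ₛ x → ¬ P ∣ₛ y → ¬ P ∣ₛ x * y
  ∤-* P∤x P∤y = [ P∤x , P∤y ]′ ∘ prime-∣-*

  ∤-1 : ¬ P ∣ₛ 1ℤ
  ∤-1 h = ¬prime[1] (subst Prime (Nᵈ.∣1⇒≡1 (Signed.∣⇒∣ᵤ h)) π-prime)

  ∤-^ : ∀ {x} → ¬ P ∣ₛ x → ∀ m → ¬ P ∣ₛ x ^ m
  ∤-^ P∤x zero = ∤-1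
  ∤-^ P∤x (suc m) = ∤-* P∤x (∤-^ P∤x m)

  ∣-*-unit : ∀ {x c} → ¬ P ∣ₛ x → P ∣ₛ c * x ⇔ P ∣ₛ c
  ∣-*-unit {x} P∤x = mk⇔ ([ id , ⊥-elim ∘ P∤x ]′ ∘ prime-∣-*) (Signed.∣m⇒∣m*n x)

  power-cancel : ∀ {c} → ¬ P ∣ₛ c → ∀ j {x} → P ^ j ∣ₛ c * x → P ^ j ∣ₛ x
  power-cancel P∤c zero {x} _ = Signed.∣ᵤ⇒∣ (Nᵈ.1∣ ∣ x ∣)
  power-cancel {c} P∤c (suc j) {x} h with to (∣-*-unit {c} {x} P∤c) (subst (P ∣ₛ_) (ℤᵖ.*-comm c x)
                                              (Signed.∣-trans (Signed.∣m⇒∣m*n (P ^ j) Signed.∣-refl) h))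
  ... | divides e refl = subst (P ^ suc j ∣ₛ_) (ℤᵖ.*-comm P e) (Signed.*-monoʳ-∣ P (power-cancel P∤c j
          (Signed.*-cancelˡ-∣ P (subst (P ^ suc j ∣ₛ_) (regroup c e P) h))))
    where
    regroup : ∀ c e P → c * (e * P) ≡ P * (c * e)
    regroup = solve-∀

  power-∣-shift : ∀ k {c} → P ^ suc k ∣ₛ P ^ k * c ⇔ P ∣ₛ c
  power-∣-shift k {c} = mk⇔
    (λ h → Signed.*-cancelˡ-∣ (P ^ k) {{power-nonZero k}} (subst (_∣ₛ P ^ k * c) (ℤᵖ.*-comm P (P ^ k)) h))
    (λ h → subst (_∣ₛ P ^ k * c) (ℤᵖ.*-comm (P ^ k) P) (Signed.*-monoʳ-∣ (P ^ k) h))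

  power-∣-transfer : ∀ {c d x y} → ¬ P ∣ₛ c → ¬ P ∣ₛ d → c * x ≡ d * y → ∀ k → P ^ k ∣ₛ x ⇔ P ^ k ∣ₛ y
  power-∣-transfer {c} {d} P∤c P∤d cx≡dy k = mk⇔
    (λ h → power-cancel P∤d k (subst (P ^ k ∣ₛ_) cx≡dy (Signed.∣n⇒∣m*n c h)))
    (λ h → power-cancel P∤c k (subst (P ^ k ∣ₛ_) (sym cx≡dy) (Signed.∣n⇒∣m*n d h)))

module QuadraticIntegers (D : ℤ) where

  record ℤ[√D] : Set where
    constructor ⟨_,_⟩
    field
      re im : ℤ
  open ℤ[√D] public

  infixl 7 _·_
  _·_ : ℤ[√D] → ℤ[√D] → ℤ[√D]
  ⟨ x , y ⟩ · ⟨ u , v ⟩ = ⟨ x * u + D * (y * v) , x * v + y * u ⟩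

  ·-assoc : ∀ a b c → (a · b) · c ≡ a · (b · c)
  ·-assoc ⟨ x , y ⟩ ⟨ u , v ⟩ ⟨ s , t ⟩ = cong₂ ⟨_,_⟩ (re-assoc D x y u v s t) (im-assoc D x y u v s t)
    where
    re-assoc : ∀ D x y u v s t →
      (x * u + D * (y * v)) * s + D * ((x * v + y * u) * t) ≡ x * (u * s + D * (v * t)) + D * (y * (u * t + v * s))
    re-assoc = solve-∀
    im-assoc : ∀ D x y u v s t →
      (x * u + D * (y * v)) * t + (x * v + y * u) * s ≡ x * (u * t + v * s) + y * (u * s + D * (v * t))
    im-assoc = solve-∀

  ·-identityˡ : ∀ a → ⟨ 1ℤ , 0ℤ ⟩ · a ≡ a
  ·-identityˡ ⟨ x , y ⟩ = cong₂ ⟨_,_⟩ (re-identity D x y) (im-identity x y)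
    where
    re-identity : ∀ D x y → 1ℤ * x + D * (0ℤ * y) ≡ x
    re-identity = solve-∀
    im-identity : ∀ x y → 1ℤ * y + 0ℤ * x ≡ y
    im-identity = solve-∀

  ·-identityʳ : ∀ a → a · ⟨ 1ℤ , 0ℤ ⟩ ≡ a
  ·-identityʳ ⟨ x , y ⟩ = cong₂ ⟨_,_⟩ (re-identity D x y) (im-identity x y)
    where
    re-identity : ∀ D x y → x * 1ℤ + D * (y * 0ℤ) ≡ x
    re-identity = solve-∀
    im-identity : ∀ x y → x * 0ℤ + y * 1ℤ ≡ y
    im-identity = solve-∀

  monoid : Monoid 0ℓ 0ℓ
  monoid = record
    { Carrier  = ℤ[√D]
    ; _≈_      = _≡_
    ; _∙_      = _·_
    ; ε        = ⟨ 1ℤ , 0ℤ ⟩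
    ; isMonoid = record
      { isSemigroup = record
        { isMagma = record { isEquivalence = isEquivalence ; ∙-cong = cong₂ _·_ }
        ; assoc   = ·-assoc
        }
      ; identity    = ·-identityˡ , ·-identityʳ
      }
    }

  -- pow m e = e^m, with e^(m+1) = e · e^m
  open MonoidMultiplication monoid public
    using () renaming (_×_ to pow; ×-homo-1 to pow-1; ×-assocˡ to pow-pow)

  -- First-order binomial theorem: (A + B√D)^m ≡ A^m + m·A^(m-1)·B·√D modulo B²D,
  -- all further terms of the expansion being multiples of B²D.
  first-order : ∀ A B m →
    re (pow m ⟨ A , B ⟩) ≡ A ^ m mod B * B * D ×
    im (pow m ⟨ A , B ⟩) ≡ + m * A ^ (m ∸ 1) * B mod B * B * D
  first-order A B zero = mod-reflexive refl , mod-reflexive refl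
  first-order A B (suc m) with first-order A B m
  ... | re≡ , im≡ = re-step , im-step
    where
    open ModReasoning (B * B * D)
    X Y : ℤ
    X = re (pow m ⟨ A , B ⟩)
    Y = im (pow m ⟨ A , B ⟩)
    collect : ∀ A Am c B D → A * Am + D * (B * (c * B)) ≡ A * Am + c * (B * B * D)
    collect = solve-∀
    regroup : ∀ c Am B → c * Am * B + B * Am ≡ (1ℤ + c) * Am * B
    regroup = solve-∀
    re-step : A * X + D * (B * Y) ≡ A * A ^ m mod B * B * D
    re-step = begin
      A * X + D * (B * Y)                              ≈⟨ mod-+ (mod-*ˡ A re≡) (mod-*ˡ D (mod-*ˡ B im≡)) ⟩
      A * A ^ m + D * (B * (+ m * A ^ (m ∸ 1) * B))     ≡⟨ collect A (A ^ m) (+ m * A ^ (m ∸ 1)) B D ⟩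
      A * A ^ m + + m * A ^ (m ∸ 1) * (B * B * D)       ≈⟨ mod-drop (A * A ^ m) (+ m * A ^ (m ∸ 1)) ⟩
      A * A ^ m                                        ∎
    im-step : A * Y + B * X ≡ + suc m * A ^ m * B mod B * B * D
    im-step = begin
      A * Y + B * X                                    ≈⟨ mod-+ (mod-*ˡ A im≡) (mod-*ˡ B re≡) ⟩
      A * (+ m * A ^ (m ∸ 1) * B) + B * A ^ m           ≡⟨ cong (_+ B * A ^ m) (sym (ℤᵖ.*-assoc A _ B)) ⟩
      A * (+ m * A ^ (m ∸ 1)) * B + B * A ^ m           ≡⟨ cong (λ c → c * B + B * A ^ m) (derivative-shift A m) ⟩
      + m * A ^ m * B + B * A ^ m                      ≡⟨ regroup (+ m) (A ^ m) B ⟩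
      + suc m * A ^ m * B                              ∎

  im-first-order : ∀ A m → A * im (pow m ⟨ A , 1ℤ ⟩) ≡ + m * A ^ m mod D
  im-first-order A m = begin
    A * im (pow m ⟨ A , 1ℤ ⟩)    ≈⟨ mod-*ˡ A (mod-weaken D∣D (proj₂ (first-order A 1ℤ m))) ⟩
    A * (+ m * A ^ (m ∸ 1) * 1ℤ)  ≡⟨ cong (A *_) (ℤᵖ.*-identityʳ _) ⟩
    A * (+ m * A ^ (m ∸ 1))       ≡⟨ derivative-shift A m ⟩
    + m * A ^ m                  ∎
    where
    open ModReasoning D
    D∣D : D ∣ₛ 1ℤ * 1ℤ * D
    D∣D = Signed.∣-reflexive (sym (ℤᵖ.*-identityˡ D))

  -- Second-order binomial theorem for A + √D modulo D², with the
  -- denominators 2 and 6 of m(m-1)/2 and m(m-1)(m-2)/6 cleared: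
  -- (A + √D)^m ≡ (A^m + C(m,2)A^(m-2)D) + (mA^(m-1) + C(m,3)A^(m-3)D)√D.
  second-order : ∀ A m →
    + 2 * A * A * re (pow m ⟨ A , 1ℤ ⟩)
      ≡ + 2 * (A * A * A ^ m) + + m * (+ m - 1ℤ) * A ^ m * D mod D * D ×
    + 6 * A * A * A * im (pow m ⟨ A , 1ℤ ⟩)
      ≡ + 6 * + m * (A * A * A ^ m) + + m * (+ m - 1ℤ) * (+ m - + 2) * A ^ m * D mod D * D
  second-order A zero = mod-reflexive (re-base A D) , mod-reflexive (im-base A D)
    where
    re-base : ∀ A D → + 2 * A * A * 1ℤ ≡ + 2 * (A * A * 1ℤ) + + 0 * (+ 0 - 1ℤ) * 1ℤ * D
    re-base = solve-∀
    im-base : ∀ A D → + 6 * A * A * A * 0ℤ ≡ + 6 * + 0 * (A * A * 1ℤ) + + 0 * (+ 0 - 1ℤ) * (+ 0 - + 2) * 1ℤ * D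
    im-base = solve-∀
  second-order A (suc m) with second-order A m
  ... | re≡ , im≡ = re-step , im-step
    where
    open ModReasoning (D * D)
    X Y M Am : ℤ
    X = re (pow m ⟨ A , 1ℤ ⟩)
    Y = im (pow m ⟨ A , 1ℤ ⟩)
    M = + m
    Am = A ^ m
    re-split : ∀ A D X Y → + 2 * A * A * (A * X + D * (1ℤ * Y)) ≡ A * (+ 2 * A * A * X) + + 2 * A * (D * (A * Y))
    re-split = solve-∀
    re-collect : ∀ A D M Am →
      A * (+ 2 * (A * A * Am) + M * (M - 1ℤ) * Am * D) + + 2 * A * (D * (M * Am))
        ≡ + 2 * (A * A * (A * Am)) + (1ℤ + M) * ((1ℤ + M) - 1ℤ) * (A * Am) * D
    re-collect = solve-∀
    im-split : ∀ A X Y → + 6 * A * A * A * (A * Y + 1ℤ * X) ≡ A * (+ 6 * A * A * A * Y) + + 3 * A * (+ 2 * A * A * X)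
    im-split = solve-∀
    im-collect : ∀ A D M Am →
      A * (+ 6 * M * (A * A * Am) + M * (M - 1ℤ) * (M - + 2) * Am * D) + + 3 * A * (+ 2 * (A * A * Am) + M * (M - 1ℤ) * Am * D)
        ≡ + 6 * (1ℤ + M) * (A * A * (A * Am)) + (1ℤ + M) * ((1ℤ + M) - 1ℤ) * ((1ℤ + M) - + 2) * (A * Am) * D
    im-collect = solve-∀
    re-step : + 2 * A * A * (A * X + D * (1ℤ * Y))
                ≡ + 2 * (A * A * (A * Am)) + (1ℤ + M) * ((1ℤ + M) - 1ℤ) * (A * Am) * D mod D * D
    re-step = begin
      + 2 * A * A * (A * X + D * (1ℤ * Y))
        ≡⟨ re-split A D X Y ⟩
      A * (+ 2 * A * A * X) + + 2 * A * (D * (A * Y))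
        ≈⟨ mod-+ (mod-*ˡ A re≡) (mod-*ˡ (+ 2 * A) (mod-scale D (im-first-order A m))) ⟩
      A * (+ 2 * (A * A * Am) + M * (M - 1ℤ) * Am * D) + + 2 * A * (D * (M * Am))
        ≡⟨ re-collect A D M Am ⟩
      + 2 * (A * A * (A * Am)) + (1ℤ + M) * ((1ℤ + M) - 1ℤ) * (A * Am) * D
        ∎
    im-step : + 6 * A * A * A * (A * Y + 1ℤ * X)
                ≡ + 6 * (1ℤ + M) * (A * A * (A * Am)) + (1ℤ + M) * ((1ℤ + M) - 1ℤ) * ((1ℤ + M) - + 2) * (A * Am) * D mod D * D
    im-step = begin
      + 6 * A * A * A * (A * Y + 1ℤ * X)
        ≡⟨ im-split A X Y ⟩
      A * (+ 6 * A * A * A * Y) + + 3 * A * (+ 2 * A * A * X)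
        ≈⟨ mod-+ (mod-*ˡ A im≡) (mod-*ˡ (+ 3 * A) re≡) ⟩
      A * (+ 6 * M * (A * A * Am) + M * (M - 1ℤ) * (M - + 2) * Am * D) + + 3 * A * (+ 2 * (A * A * Am) + M * (M - 1ℤ) * Am * D)
        ≡⟨ im-collect A D M Am ⟩
      + 6 * (1ℤ + M) * (A * A * (A * Am)) + (1ℤ + M) * ((1ℤ + M) - 1ℤ) * ((1ℤ + M) - + 2) * (A * Am) * D
        ∎

  im-recurrence : ∀ a n →
    im (pow (2 N.+ n) ⟨ a , 1ℤ ⟩) ≡ + 2 * a * im (pow (1 N.+ n) ⟨ a , 1ℤ ⟩) + (D - a * a) * im (pow n ⟨ a , 1ℤ ⟩)
  im-recurrence a n = unfold D a (re (pow n ⟨ a , 1ℤ ⟩)) (im (pow n ⟨ a , 1ℤ ⟩))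
    where
    unfold : ∀ D a X Y →
      a * (a * Y + 1ℤ * X) + 1ℤ * (a * X + D * (1ℤ * Y)) ≡ + 2 * a * (a * Y + 1ℤ * X) + (D - a * a) * Y
    unfold = solve-∀

module Valuation {π : ℕ} (π-prime : Prime π) where

  P : ℤ
  P = + π

  open PrimeDivisibility π-prime public
  open QuadraticIntegers P public

  Exactly : ℕ → ℤ → Set
  Exactly k x = Σ[ u ∈ ℤ ] x ≡ u * P ^ k × ¬ P ∣ₛ u

  record Level (k : ℕ) (e : ℤ[√D]) : Set where
    constructor level
    field
      A u       : ℤ
      shape     : e ≡ ⟨ A , u * P ^ k ⟩
      A-coprime : ¬ P ∣ₛ A
      u-coprime : ¬ P ∣ₛ u

  level-from : ∀ {k e} → ¬ P ∣ₛ re e → Exactly k (im e) → Level k e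
  level-from {e = e} P∤re (u , im≡ , P∤u) = level (re e) u (cong ⟨ re e ,_⟩ im≡) P∤re P∤u

  exact-from-congruence : ∀ j {w x v} → w * x ≡ P ^ j * v mod P ^ suc j →
                          ¬ P ∣ₛ w → ¬ P ∣ₛ v → Exactly j x
  exact-from-congruence j {w} {x} {v} congruence P∤w P∤v = exact (power-cancel P∤w j Pʲ∣wx)
    where
    -- π^j divides π^j·v, hence w·x by the congruence, hence x as π ∤ w
    Pʲ∣wx : P ^ j ∣ₛ w * x
    Pʲ∣wx = from (mod-∣ congruence (divides P refl)) (Signed.∣m⇒∣m*n v Signed.∣-refl)
    -- if x = u·π^j with π ∣ u, then π^(j+1) divides w·x, hence π^j·v, so π ∣ v
    exact : P ^ j ∣ₛ x → Exactly j x
    exact (divides u x≡uPʲ) = u , x≡uPʲ , λ P∣u → P∤v (to (power-∣-shift j) (to (mod-∣ congruence Signed.∣-refl)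
      (Signed.∣n⇒∣m*n w (subst (P ^ suc j ∣ₛ_) (sym x≡uPʲ) (Signed.*-monoˡ-∣ (P ^ j) P∣u)))))

  -- The rational part of a power stays prime to π: it is ≡ A^m mod π.
  re-power : ∀ {e} → ¬ P ∣ₛ re e → ∀ m → ¬ P ∣ₛ re (pow m e)
  re-power {e} P∤A m P∣re =
    ∤-^ P∤A m (to (mod-∣ (proj₁ (first-order (re e) (im e) m)) P∣BBP) P∣re)
    where
    P∣BBP : P ∣ₛ im e * im e * P
    P∣BBP = Signed.∣n⇒∣m*n (im e * im e) Signed.∣-refl

  im-power : ∀ k A u m → let B = u * P ^ k in
    im (pow m ⟨ A , B ⟩) ≡ P ^ k * (+ m * A ^ (m ∸ 1) * u) mod B * B * P
  im-power k A u m = begin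
    im (pow m ⟨ A , u * P ^ k ⟩)         ≈⟨ proj₂ (first-order A (u * P ^ k) m) ⟩
    + m * A ^ (m ∸ 1) * (u * P ^ k)       ≡⟨ regroup (+ m * A ^ (m ∸ 1)) u (P ^ k) ⟩
    P ^ k * (+ m * A ^ (m ∸ 1) * u)       ∎
    where
    open ModReasoning (u * P ^ k * (u * P ^ k) * P)
    regroup : ∀ c u x → c * (u * x) ≡ x * (c * u)
    regroup = solve-∀

  reduce : ∀ {k e} → Level k e → ∀ m → P ^ suc k ∣ₛ im (pow m e) ⇔ π Nᵈ.∣ m
  reduce {k} (level A u refl P∤A P∤u) m = begin
    P ^ suc k ∣ₛ im (pow m ⟨ A , u * P ^ k ⟩)  ≈⟨ mod-∣ (im-power k A u m) divides-modulus ⟩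
    P ^ suc k ∣ₛ P ^ k * (+ m * A ^ (m ∸ 1) * u)  ≈⟨ power-∣-shift k ⟩
    P ∣ₛ + m * A ^ (m ∸ 1) * u                 ≈⟨ ∣-*-unit P∤u ⟩
    P ∣ₛ + m * A ^ (m ∸ 1)                     ≈⟨ ∣-*-unit (∤-^ P∤A (m ∸ 1)) ⟩
    P ∣ₛ + m                                  ≈⟨ mk⇔ Signed.∣⇒∣ᵤ Signed.∣ᵤ⇒∣ ⟩
    π Nᵈ.∣ m                                  ∎
    where
    open ⇔-Reasoning
    divides-modulus : P ^ suc k ∣ₛ u * P ^ k * (u * P ^ k) * P
    divides-modulus = divides (u * u * P ^ k) (expand u (P ^ k) P)
      where
      expand : ∀ u x P → u * x * (u * x) * P ≡ u * u * x * (P * x)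
      expand = solve-∀

  lift : ∀ {k e} → Level (suc k) e → Level (suc (suc k)) (pow π e)
  lift {k} (level A u refl P∤A P∤u) =
    level-from (re-power P∤A π)
      (exact-from-congruence (suc (suc k)) congruence ∤-1 (∤-* (∤-^ P∤A (π ∸ 1)) P∤u))
    where
    B : ℤ
    B = u * P ^ suc k
    divides-modulus : P ^ suc (suc (suc k)) ∣ₛ B * B * P
    divides-modulus = divides (u * u * P ^ k) (expand u (P ^ k) P)
      where
      expand : ∀ u y P → u * (P * y) * (u * (P * y)) * P ≡ u * u * y * (P * (P * (P * y)))
      expand = solve-∀
    regroup : ∀ P x c u → x * (P * c * u) ≡ P * x * (c * u)
    regroup = solve-∀
    congruence : 1ℤ * im (pow π ⟨ A , B ⟩) ≡ P ^ suc (suc k) * (A ^ (π ∸ 1) * u) mod P ^ suc (suc (suc k))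
    congruence = begin
      1ℤ * im (pow π ⟨ A , B ⟩)                 ≡⟨ ℤᵖ.*-identityˡ _ ⟩
      im (pow π ⟨ A , B ⟩)                      ≈⟨ mod-weaken divides-modulus (im-power (suc k) A u π) ⟩
      P ^ suc k * (P * A ^ (π ∸ 1) * u)          ≡⟨ regroup P (P ^ suc k) (A ^ (π ∸ 1)) u ⟩
      P ^ suc (suc k) * (A ^ (π ∸ 1) * u)        ∎
      where open ModReasoning (P ^ suc (suc (suc k)))

  -- For π ≥ 5 the second-order expansion gives 6a³·Y_π ≡ π·6a^(π+2) mod π²,
  -- so a + √π raised to π has level 1.
  level-one-large : 5 N.≤ π → ∀ {a} → ¬ P ∣ₛ a → Level 1 (pow π ⟨ a , 1ℤ ⟩)
  level-one-large 5≤π {a} P∤a =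
    level-from (re-power P∤a π)
      (exact-from-congruence 1 congruence (∤-* (∤-* (∤-* P∤6 P∤a) P∤a) P∤a)
        (∤-* P∤6 (∤-* (∤-* P∤a P∤a) (∤-^ P∤a π))))
    where
    P∤6 : ¬ P ∣ₛ + 6
    P∤6 P∣6 = [ Nᵈ.>⇒∤ 2<π , Nᵈ.>⇒∤ 3<π ]′ (euclidsLemma 2 3 π-prime (Signed.∣⇒∣ᵤ P∣6))
      where
      2<π : 2 N.< π
      2<π = Nᵖ.≤-trans (s≤s (s≤s (s≤s z≤n))) 5≤π
      3<π : 3 N.< π
      3<π = Nᵖ.≤-trans (s≤s (s≤s (s≤s (s≤s z≤n)))) 5≤π
    Y : ℤ
    Y = im (pow π ⟨ a , 1ℤ ⟩)
    collect : ∀ P a A → + 6 * P * (a * a * A) + P * (P - 1ℤ) * (P - + 2) * A * P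
                          ≡ P * 1ℤ * (+ 6 * (a * a * A)) + (P - 1ℤ) * (P - + 2) * A * (P * P)
    collect = solve-∀
    P²∣PP : P ^ 2 ∣ₛ P * P
    P²∣PP = Signed.∣-reflexive (cong (P *_) (ℤᵖ.*-identityʳ P))
    congruence : + 6 * a * a * a * Y ≡ P ^ 1 * (+ 6 * (a * a * a ^ π)) mod P ^ 2
    congruence = mod-weaken P²∣PP (begin
      + 6 * a * a * a * Y                                                     ≈⟨ proj₂ (second-order a π) ⟩
      + 6 * P * (a * a * a ^ π) + P * (P - 1ℤ) * (P - + 2) * a ^ π * P         ≡⟨ collect P a (a ^ π) ⟩
      P * 1ℤ * (+ 6 * (a * a * a ^ π)) + (P - 1ℤ) * (P - + 2) * a ^ π * (P * P) ≈⟨ mod-drop _ ((P - 1ℤ) * (P - + 2) * a ^ π) ⟩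
      P ^ 1 * (+ 6 * (a * a * a ^ π))                                          ∎)
      where open ModReasoning (P * P)

three-∤-square+1 : ∀ {a} → ¬ + 3 ∣ₛ a → ¬ + 3 ∣ₛ a * a + 1ℤ
three-∤-square+1 {a} 3∤a 3∣a²+1 =
  by-remainder (a % + 3) (n%d<d a (+ 3)) a≡r (to (mod-∣ (mod-+ (mod-* a≡r a≡r) (mod-reflexive refl)) Signed.∣-refl) 3∣a²+1)
  where
  a≡r : a ≡ + (a % + 3) mod + 3
  a≡r = begin
    a                                  ≡⟨ a≡a%n+[a/n]*n a (+ 3) ⟩
    + (a % + 3) + (a / + 3) * + 3      ≈⟨ mod-drop (+ (a % + 3)) (a / + 3) ⟩
    + (a % + 3)                        ∎
    where open ModReasoning (+ 3)
  by-remainder : ∀ r → r N.< 3 → a ≡ + r mod + 3 → ¬ + 3 ∣ₛ + r * + r + 1ℤ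
  by-remainder 0 _ a≡0 _ = 3∤a (from (mod-∣ a≡0 Signed.∣-refl) (divides 0ℤ refl))
  by-remainder 1 _ _ = from-no (+ 3 Signed.∣? + 2)
  by-remainder 2 _ _ = from-no (+ 3 Signed.∣? + 5)
  by-remainder (suc (suc (suc _))) (s≤s (s≤s (s≤s ()))) _

-- The first lifting step: a + √π raised to π has level 1 whenever π ∤ a.
-- For π = 2, 3 it is computed directly: the √π-parts are 2a and 3(a² + 1).
level-one : ∀ {π} (π-prime : Prime π) {a} → ¬ + π ∣ₛ a →
  let open Valuation π-prime in Level 1 (pow π ⟨ a , 1ℤ ⟩)
level-one {0} π-prime _ = ⊥-elim (¬prime[0] π-prime)
level-one {1} π-prime _ = ⊥-elim (¬prime[1] π-prime)
level-one {2} π-prime {a} 2∤a = level-from (re-power {⟨ a , 1ℤ ⟩} 2∤a 2) (a , square a , 2∤a)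
  where
  open Valuation π-prime
  square : ∀ a → a * (a * 0ℤ + 1ℤ * 1ℤ) + 1ℤ * (a * 1ℤ + + 2 * (1ℤ * 0ℤ)) ≡ a * (+ 2 * 1ℤ)
  square = solve-∀
level-one {3} π-prime {a} 3∤a = level-from (re-power {⟨ a , 1ℤ ⟩} 3∤a 3) (a * a + 1ℤ , cube a , three-∤-square+1 3∤a)
  where
  open Valuation π-prime
  cube : ∀ a → let X₁ = a * 1ℤ + + 3 * (1ℤ * 0ℤ) ; Y₁ = a * 0ℤ + 1ℤ * 1ℤ in
    a * (a * Y₁ + 1ℤ * X₁) + 1ℤ * (a * X₁ + + 3 * (1ℤ * Y₁)) ≡ (a * a + 1ℤ) * (+ 3 * 1ℤ)
  cube = solve-∀
level-one {4} π-prime _ = ⊥-elim (composite⇒¬prime composite[4] π-prime)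
level-one {suc (suc (suc (suc (suc _))))} π-prime = Valuation.level-one-large π-prime (s≤s (s≤s (s≤s (s≤s (s≤s z≤n)))))

module _ {π : ℕ} (π-prime : Prime π) {a : ℤ} (π∤a : ¬ + π ∣ₛ a) where

  open Valuation π-prime

  levels : ∀ k → Level k (pow (π N.^ k) ⟨ a , 1ℤ ⟩)
  levels zero = subst (Level 0) (sym (pow-1 ⟨ a , 1ℤ ⟩)) (level a 1ℤ refl π∤a ∤-1)
  levels (suc zero) = subst (λ n → Level 1 (pow n ⟨ a , 1ℤ ⟩)) (sym (Nᵖ.*-identityʳ π)) (level-one π-prime π∤a)
  levels (suc (suc k)) = subst (Level (suc (suc k))) (pow-pow ⟨ a , 1ℤ ⟩ π (π N.^ suc k)) (lift (levels (suc k)))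

  valuation : ∀ k n → π N.^ k Nᵈ.∣ n ⇔ P ^ k ∣ₛ im (pow n ⟨ a , 1ℤ ⟩)
  valuation zero n = mk⇔ (λ _ → Signed.∣ᵤ⇒∣ (Nᵈ.1∣ _)) (λ _ → Nᵈ.1∣ n)
  valuation (suc k) n = mk⇔
    (λ h → to (at-multiple-of-π^k (Nᵈ.∣-trans (Nᵈ.n∣m*n π) h)) h)
    (λ h → from (at-multiple-of-π^k (from (valuation k n) (Signed.∣-trans (Signed.∣n⇒∣m*n P Signed.∣-refl) h))) h)
    where
    -- once n = m·π^k, both divisibilities by the (k+1)-st power say π ∣ m
    at-multiple-of-π^k : π N.^ k Nᵈ.∣ n → π N.^ suc k Nᵈ.∣ n ⇔ P ^ suc k ∣ₛ im (pow n ⟨ a , 1ℤ ⟩)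
    at-multiple-of-π^k (Nᵈ.divides m n≡mπᵏ) =
      subst (λ n → π N.^ suc k Nᵈ.∣ n ⇔ P ^ suc k ∣ₛ im (pow n ⟨ a , 1ℤ ⟩)) (sym n≡mπᵏ) (begin
        π N.^ suc k Nᵈ.∣ m N.* π N.^ k                   ≈⟨ mk⇔ (Nᵈ.*-cancelʳ-∣ (π N.^ k) {{π^k≢0}}) (Nᵈ.*-monoˡ-∣ (π N.^ k)) ⟩
        π Nᵈ.∣ m                                         ≈⟨ reduce (levels k) m ⟨
        P ^ suc k ∣ₛ im (pow m (pow (π N.^ k) ⟨ a , 1ℤ ⟩))  ≡⟨ cong (λ e → P ^ suc k ∣ₛ im e) (pow-pow ⟨ a , 1ℤ ⟩ m (π N.^ k)) ⟩
        P ^ suc k ∣ₛ im (pow (m N.* π N.^ k) ⟨ a , 1ℤ ⟩)     ∎)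
      where
      open ⇔-Reasoning
      π^k≢0 : N.NonZero (π N.^ k)
      π^k≢0 = Nᵖ.m^n≢0 π k {{prime⇒nonZero π-prime}}

recurrence-unique : ∀ α β (f g : ℕ → ℤ) → f 0 ≡ g 0 → f 1 ≡ g 1 →
  (∀ n → f (2 N.+ n) ≡ α * f (1 N.+ n) + β * f n) →
  (∀ n → g (2 N.+ n) ≡ α * g (1 N.+ n) + β * g n) →
  ∀ n → f n ≡ g n
recurrence-unique α β f g f0≡g0 f1≡g1 f-rec g-rec n = proj₁ (consecutive n)
  where
  consecutive : ∀ n → f n ≡ g n × f (suc n) ≡ g (suc n)
  consecutive zero = f0≡g0 , f1≡g1
  consecutive (suc n) with consecutive n
  ... | fn≡gn , fn+1≡gn+1 = fn+1≡gn+1 , (begin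
    f (2 N.+ n)                  ≡⟨ f-rec n ⟩
    α * f (1 N.+ n) + β * f n    ≡⟨ cong₂ (λ x y → α * x + β * y) fn+1≡gn+1 fn≡gn ⟩
    α * g (1 N.+ n) + β * g n    ≡⟨ g-rec n ⟨
    g (2 N.+ n)                  ∎)
    where open ≡-Reasoning

twice-im≡G : ∀ p q {D} → D ≡ disc p q →
  let open QuadraticIntegers D in ∀ n → + 2 * im (pow n ⟨ p , 1ℤ ⟩) ≡ (+ 2) ^ n * G p q n
twice-im≡G p q refl = recurrence-unique (+ 2 * p) (+ 4 * q)
  (λ n → + 2 * im (pow n ⟨ p , 1ℤ ⟩)) (λ n → (+ 2) ^ n * G p q n) refl (initial p) Y-rec G-rec
  where
  open QuadraticIntegers (disc p q)
  initial : ∀ p → + 2 * (p * 0ℤ + 1ℤ * 1ℤ) ≡ + 2 * 1ℤ * 1ℤ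
  initial = solve-∀
  Y-step : ∀ p q Y₀ Y₁ → + 2 * (+ 2 * p * Y₁ + ((p * p + + 4 * q) - p * p) * Y₀) ≡ + 2 * p * (+ 2 * Y₁) + + 4 * q * (+ 2 * Y₀)
  Y-step = solve-∀
  G-step : ∀ p q x G₀ G₁ → + 2 * (+ 2 * x) * (p * G₁ + q * G₀) ≡ + 2 * p * (+ 2 * x * G₁) + + 4 * q * (x * G₀)
  G-step = solve-∀
  Y-rec : ∀ n → + 2 * im (pow (2 N.+ n) ⟨ p , 1ℤ ⟩)
            ≡ + 2 * p * (+ 2 * im (pow (1 N.+ n) ⟨ p , 1ℤ ⟩)) + + 4 * q * (+ 2 * im (pow n ⟨ p , 1ℤ ⟩))
  Y-rec n = trans (cong (+ 2 *_) (im-recurrence p n)) (Y-step p q _ _)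
  G-rec : ∀ n → (+ 2) ^ (2 N.+ n) * G p q (2 N.+ n) ≡ + 2 * p * ((+ 2) ^ (1 N.+ n) * G p q (1 N.+ n)) + + 4 * q * ((+ 2) ^ n * G p q n)
  G-rec n = G-step p q ((+ 2) ^ n) (G p q n) (G p q (suc n))

im≡G : ∀ t q {D} → D ≡ t * t + q →
  let open QuadraticIntegers D in ∀ n → im (pow n ⟨ t , 1ℤ ⟩) ≡ G (t * + 2) q n
im≡G t q refl = recurrence-unique (t * + 2) q
  (λ n → im (pow n ⟨ t , 1ℤ ⟩)) (G (t * + 2) q) refl (initial t) Y-rec (λ _ → refl)
  where
  open QuadraticIntegers (t * t + q)
  initial : ∀ t → t * 0ℤ + 1ℤ * 1ℤ ≡ + 1
  initial = solve-∀
  Y-step : ∀ t q Y₀ Y₁ → + 2 * t * Y₁ + ((t * t + q) - t * t) * Y₀ ≡ t * + 2 * Y₁ + q * Y₀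
  Y-step = solve-∀
  Y-rec : ∀ n → im (pow (2 N.+ n) ⟨ t , 1ℤ ⟩) ≡ t * + 2 * im (pow (1 N.+ n) ⟨ t , 1ℤ ⟩) + q * im (pow n ⟨ t , 1ℤ ⟩)
  Y-rec n = trans (im-recurrence t n) (Y-step t q _ _)

-- A number π = t² + c with c > 0 does not divide t ≠ 0, since |t| ≤ t² < π.
root-∤ : ∀ {π c} t → + π ≡ t * t + + c → 0 N.< c → t ≢ 0ℤ → ¬ + π ∣ₛ t
root-∤ {π} {c} t π≡t²+c 0<c t≢0 π∣t = Nᵖ.<-irrefl refl (begin-strict
  π                        ≤⟨ Nᵈ.∣⇒≤ (Signed.∣⇒∣ᵤ π∣t) ⟩
  ∣ t ∣                    ≤⟨ Nᵖ.m≤m*n ∣ t ∣ ∣ t ∣ ⟩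
  ∣ t ∣ N.* ∣ t ∣          <⟨ Nᵖ.m<m+n (∣ t ∣ N.* ∣ t ∣) 0<c ⟩
  ∣ t ∣ N.* ∣ t ∣ N.+ c    ≡⟨ ℤᵖ.+-injective (trans π≡t²+c (cong (_+ + c) (square-abs t))) ⟨
  π                        ∎)
  where
  open Nᵖ.≤-Reasoning
  instance
    |t|≢0 : N.NonZero ∣ t ∣
    |t|≢0 = N.≢-nonZero (λ |t|≡0 → t≢0 (ℤᵖ.∣i∣≡0⇒i≡0 |t|≡0))

unsigned-form : ∀ {π k n x} → π N.^ k Nᵈ.∣ n ⇔ (+ π) ^ k ∣ₛ x → ((+ π) ^ k ∣ + n) ⇔ ((+ π) ^ k ∣ x)
unsigned-form {π} {k} {n} equivalence = mk⇔
  (λ h → Signed.∣⇒∣ᵤ (to equivalence (subst (Nᵈ._∣ n) |π^k| h)))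
  (λ h → subst (Nᵈ._∣ n) (sym |π^k|) (from equivalence (Signed.∣ᵤ⇒∣ h)))
  where
  |π^k| : ∣ (+ π) ^ k ∣ ≡ π N.^ k
  |π^k| = cong ∣_∣ (pos-^ π k)

part1 : ∀ p q → 0 N.< q → (ρ : ℕ) → Prime ρ → disc p (+ q) ≡ + ρ →
  (k n : ℕ) → ((+ ρ) ^ k ∣ + n) ⇔ ((+ ρ) ^ k ∣ G p (+ q) n)
part1 p q 0<q ρ ρ-prime disc≡ρ k n = unsigned-form {ρ} {k} {n} (begin
  ρ N.^ k Nᵈ.∣ n                          ≈⟨ valuation ρ-prime ρ∤p k n ⟩
  P ^ k ∣ₛ im (pow n ⟨ p , 1ℤ ⟩)            ≈⟨ power-∣-transfer ρ∤2 (∤-^ ρ∤2 n) (twice-im≡G p (+ q) (sym disc≡ρ) n) k ⟩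
  P ^ k ∣ₛ G p (+ q) n                      ∎)
  where
  open ⇔-Reasoning
  open Valuation ρ-prime
  0<4q : 0 N.< 4 N.* q
  0<4q = Nᵖ.*-monoʳ-< 4 0<q
  ρ≡p²+4q : + ρ ≡ p * p + + (4 N.* q)
  ρ≡p²+4q = trans (sym disc≡ρ) (cong (_+_ (p * p)) (sym (ℤᵖ.pos-* 4 q)))
  4≤ρ : 4 N.≤ ρ
  4≤ρ = Nᵖ.≤-trans (Nᵖ.m≤m*n 4 q {{N.>-nonZero 0<q}})
          (Nᵖ.≤-trans (Nᵖ.m≤n+m (4 N.* q) (∣ p ∣ N.* ∣ p ∣))
            (Nᵖ.≤-reflexive (sym (ℤᵖ.+-injective (trans ρ≡p²+4q (cong (_+ + (4 N.* q)) (square-abs p)))))))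
  ρ∤2 : ¬ P ∣ₛ + 2
  ρ∤2 ρ∣2 = Nᵈ.>⇒∤ (Nᵖ.<⇒≤ 4≤ρ) (Signed.∣⇒∣ᵤ ρ∣2)
  -- p = 0 would make r = 4q even and > 2
  p≢0 : p ≢ 0ℤ
  p≢0 p≡0 = Prime.notComposite ρ-prime (composite (Nᵖ.<⇒≤ 4≤ρ) 2∣ρ)
    where
    2∣ρ : 2 Nᵈ.∣ ρ
    2∣ρ = Nᵈ.∣-trans (Nᵈ.∣m⇒∣m*n q (Nᵈ.divides 2 refl))
            (Nᵈ.∣-reflexive (ℤᵖ.+-injective (sym (trans ρ≡p²+4q (cong (λ p → p * p + + (4 N.* q)) p≡0)))))
  ρ∤p : ¬ P ∣ₛ p
  ρ∤p = root-∤ p ρ≡p²+4q 0<4q p≢0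

even-from-disc : ∀ p q s → disc p q ≡ + 4 * s → + 2 ∣ₛ p
even-from-disc p q s disc≡4s = Sum.reduce (PrimeDivisibility.prime-∣-* prime[2] (divides (+ 2 * s - + 2 * q) p²≡))
  where
  open ≡-Reasoning
  isolate : ∀ p q → p * p ≡ (p * p + + 4 * q) - + 4 * q
  isolate = solve-∀
  halve : ∀ s q → + 4 * s - + 4 * q ≡ (+ 2 * s - + 2 * q) * + 2
  halve = solve-∀
  p²≡ : p * p ≡ (+ 2 * s - + 2 * q) * + 2
  p²≡ = begin
    p * p                          ≡⟨ isolate p q ⟩
    disc p q - + 4 * q             ≡⟨ cong (_- + 4 * q) disc≡4s ⟩
    + 4 * s - + 4 * q              ≡⟨ halve s q ⟩
    (+ 2 * s - + 2 * q) * + 2      ∎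

half-disc : ∀ t q s → disc (t * + 2) q ≡ + 4 * s → s ≡ t * t + q
half-disc t q s disc≡4s = ℤᵖ.*-cancelˡ-≡ (+ 4) s (t * t + q) (trans (sym disc≡4s) (expand t q))
  where
  expand : ∀ t q → t * + 2 * (t * + 2) + + 4 * q ≡ + 4 * (t * t + q)
  expand = solve-∀

part2 : ∀ p q → 0 N.< q → (s : ℕ) → Prime s → disc p (+ q) ≡ + 4 * + s → p ≢ + 0 →
  (k n : ℕ) → ((+ s) ^ k ∣ + n) ⇔ ((+ s) ^ k ∣ G p (+ q) n)
part2 p q 0<q s s-prime disc≡4s p≢0 k n = halving (even-from-disc p (+ q) (+ s) disc≡4s)
  where
  open Valuation s-prime
  halving : + 2 ∣ₛ p → ((+ s) ^ k ∣ + n) ⇔ ((+ s) ^ k ∣ G p (+ q) n)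
  halving (divides t p≡2t) = unsigned-form {s} {k} {n} (begin
    s N.^ k Nᵈ.∣ n                     ≈⟨ valuation s-prime s∤t k n ⟩
    P ^ k ∣ₛ im (pow n ⟨ t , 1ℤ ⟩)       ≡⟨ cong (P ^ k ∣ₛ_) (trans (im≡G t (+ q) s≡t²+q n) (cong (λ p → G p (+ q) n) (sym p≡2t))) ⟩
    P ^ k ∣ₛ G p (+ q) n                 ∎)
    where
    open ⇔-Reasoning
    s≡t²+q : + s ≡ t * t + + q
    s≡t²+q = half-disc t (+ q) (+ s) (subst (λ p → disc p (+ q) ≡ + 4 * + s) p≡2t disc≡4s)
    s∤t : ¬ P ∣ₛ t
    s∤t = root-∤ t s≡t²+q 0<q (λ t≡0 → p≢0 (trans p≡2t (cong (_* + 2) t≡0)))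

corollary1p7 : (p q : ℤ) → q > + 0 →
    ((ρ : ℕ) → Prime ρ → disc p q ≡ + ρ →
      (k n : ℕ) → ((+ ρ) ^ k ∣ + n) ⇔ ((+ ρ) ^ k ∣ G p q n))
    × ((s : ℕ) → Prime s → disc p q ≡ + 4 * + s → p ≢ + 0 →
      (k n : ℕ) → ((+ s) ^ k ∣ + n) ⇔ ((+ s) ^ k ∣ G p q n))
corollary1p7 p (+ q) (+<+ 0<q) = part1 p q 0<q , part2 p q 0<q
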